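{- Let $\varphi$ be a $\mathrm{GP}^2$ sentence in normal form. Then $\varphi$ is finitely satisfiable if and only if there exists a (finite, nonempty) colored graph $\mathcal{G}$ with vertex set $V$ satisfying: (1-type) for every vertex $v\in V$, $\mathrm{OneTp}(v)$ is compatible with $\varphi$; (2-type) for every pair of distinct vertices $v_1,v_2\in V$, $\langle\mathrm{OneTp}(v_1),\mathrm{TwoTp}(v_1,v_2),\mathrm{OneTp}(v_2)\rangle$ is compatible with $\varphi$; (Counting) for every vertex $v\in V$, the behavior vector $\mathrm{bh}(v)$ is compatible with $\varphi$ and $\mathrm{OneTp}(v)$.
   Context: Vocabulary: unary $U_1,\dots,U_n$, binary $R_1,\dots,R_m$. A 1-type is a maximal consistent subset of $\{U_i(x),\neg U_i(x)\}_{i\le n}\cup\{R_i(x,x),\neg R_i(x,x)\}_{i\le m}$ (set $\mathsf{OneTps}$). A 2-type is a maximal consistent subset of $\{R_i(x,y),\neg R_i(x,y),R_i(y,x),\neg R_i(y,x)\}_{i\le m}$ (set $\mathsf{TwoTps}$); the silent 2-type consists only of negated literals, the others are audible ($\mathsf{TwoTps}^+$); the dual $\bar\eta$ of $\eta$ swaps $x$ and $y$; $\mathsf{TwoTps}_t$ is the set of 2-types containing $R_t(x,y)$. A $\mathrm{GP}^2$ sentence in normal form is $\varphi=\forall x\,\gamma(x)\wedge\bigwedge_{i\le m}\forall x\forall y\,(R_i(x,y)\wedge x\neq y)\to\alpha_i(x,y)\wedge\bigwedge_{i\le n}\forall x\,U_i(x)\to P_i(x)$, with $\gamma,\alpha_i$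 quantifier-free and $P_i(x):=\big(\sum_{t\le m}\lambda_{i,t}\cdot\#_y[R_t(x,y)\wedge x\neq y]\big)\circledast_i\delta_i$ ($\lambda_{i,t},\delta_i\in\mathbb{Z}$, $\circledast_i$ an (in)equality, $\#_y$ counting the witnesses $y$). A 1-type $\pi$ is compatible with $\varphi$ if $\pi(x)\models\gamma(x)$. A triple $\langle\pi_1,\eta,\pi_2\rangle$ is compatible with $\varphi$ if $\pi_1(x)\wedge\eta(x,y)\wedge\pi_2(y)$ and $\pi_2(x)\wedge\bar\eta(x,y)\wedge\pi_1(y)$ both entail $\bigwedge_{i\le m}(R_i(x,y)\wedge x\neq y)\to\alpha_i(x,y)$. A colored graph is a finite set $V$ with a labelling $\mathrm{OneTp}:V\to\mathsf{OneTps}$ and, for each ordered pair of distinct $v,u$, a 2-type $\mathrm{TwoTp}(v,u)$ with $\mathrm{TwoTp}(u,v)=\overline{\mathrm{TwoTp}(v,u)}$. The behavior vector $\mathrm{bh}(v)\in\mathbb{N}^{\mathsf{TwoTps}^+\times\mathsf{OneTps}}$ has entry at $(\eta,\pi)$ equal to the number of $u\neq v$ with $\mathrm{TwoTp}(v,u)=\eta$ and $\mathrm{OneTp}(u)=\pi$. For a 1-type $\pi$, the characteristic system $\mathcal{C}^\varphi_\pi$ has variables $x_{\eta,\pi'}$ ($\eta\in\mathsf{TwoTps}^+,\pi'\in\mathsf{OneTps}$), the constraints $x_{\eta,\pi'}=0$ whenever $\pi'$ or $\langle\pi,\eta,\pi'\rangle$ is not compatible with $\varphi$, and, for each $i$ with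 $U_i(x)\in\pi$, the constraint $\big(\sum_{t\le m}\lambda_{i,t}\sum_{\eta\in\mathsf{TwoTps}_t}\sum_{\pi'\in\mathsf{OneTps}}x_{\eta,\pi'}\big)\circledast_i\delta_i$. A vector $\mathbf{f}$ is compatible with $\varphi$ and $\pi$ if it is a natural-number solution of $\mathcal{C}^\varphi_\pi$. $\varphi$ is finitely satisfiable if it has a finite model. -}

module Defs where

open import Data.Bool using (Bool; true; false; _∧_; _∨_; not; T)
open import Data.Bool.Properties using () renaming (_≟_ to _≟B_)
open import Data.Nat using (ℕ; zero; suc)
open import Data.Integer using (ℤ; +_; _≤_; _<_) renaming (_+_ to _+ℤ_; _*_ to _*ℤ_)
open import Data.Fin using (Fin; zero; suc) renaming (_≟_ to _≟F_)
open import Data.Nat.ListAction using (sum)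
open import Data.List using (List; []; _∷_; length; filterᵇ; foldr; map; cartesianProduct; concatMap; allFin)
open import Data.Vec using (Vec; []; _∷_; tabulate; replicate; lookup)
import Data.Vec.Properties as VP
import Data.Product.Properties as PP
open import Data.Product using (_×_; _,_; proj₁; proj₂; swap; Σ; ∃-syntax)
open import Relation.Binary.PropositionalEquality using (_≡_; _≢_)
open import Relation.Binary.Definitions using (DecidableEquality)
open import Relation.Nullary.Decidable using (⌊_⌋)
open import Relation.Nullary using (¬_)
open import Data.Sum using (_⊎_)

record Structure (n m N : ℕ) : Set where
  field
    U : Fin n → Fin N → Bool
    R : Fin m → Fin N → Fin N → Bool
open Structure public

data QF (n m k : ℕ) : Set where
  ⊤′     : QF n m k
  unary  : Fin n → Fin k → QF n m k
  binary : Fin m → Fin k → Fin k → QF n m k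
  equal  : Fin k → Fin k → QF n m k
  ¬′_    : QF n m k → QF n m k
  _∧′_   : QF n m k → QF n m k → QF n m k
  _∨′_   : QF n m k → QF n m k → QF n m k

eval : ∀ {n m N k} → Structure n m N → QF n m k → (Fin k → Fin N) → Bool
eval A ⊤′ ρ = true
eval A (unary i v) ρ = U A i (ρ v)
eval A (binary i v w) ρ = R A i (ρ v) (ρ w)
eval A (equal v w) ρ = ⌊ ρ v ≟F ρ w ⌋
eval A (¬′ φ) ρ = not (eval A φ ρ)
eval A (φ ∧′ ψ) ρ = eval A φ ρ ∧ eval A ψ ρ
eval A (φ ∨′ ψ) ρ = eval A φ ρ ∨ eval A ψ ρ

env1 : ∀ {N} → Fin N → Fin 1 → Fin N
env1 a _ = a

env2 : ∀ {N} → Fin N → Fin N → Fin 2 → Fin N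
env2 a b zero = a
env2 a b (suc _) = b

data Cmp : Set where
  eqC leC ltC geC gtC : Cmp

holds : Cmp → ℤ → ℤ → Set
holds eqC a b = a ≡ b
holds leC a b = a ≤ b
holds ltC a b = a < b
holds geC a b = b ≤ a
holds gtC a b = b < a

sumℤ : List ℤ → ℤ
sumℤ = foldr _+ℤ_ (+ 0)

Σℤ : ∀ {m} → (Fin m → ℤ) → ℤ
Σℤ {m} c = sumℤ (map c (allFin m))

-- GP² sentences in normal form
--   ∀x γ(x) ∧ ⋀_i ∀x∀y (R_i(x,y) ∧ x≠y → α_i(x,y)) ∧ ⋀_i ∀x (U_i(x) → P_i(x))
-- with P_i(x) := (Σ_t λ_{i,t} · #_y[R_t(x,y) ∧ x≠y]) ⊛_i δ_i.

record GP2 (n m : ℕ) : Set where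
  field
    γ   : QF n m 1
    α   : Fin m → QF n m 2
    λc  : Fin n → Fin m → ℤ
    δ   : Fin n → ℤ
    cmp : Fin n → Cmp
open GP2 public

countᵇ : ∀ {N} → (Fin N → Bool) → ℕ
countᵇ {N} p = length (filterᵇ p (allFin N))

outDeg : ∀ {n m N} → Structure n m N → Fin m → Fin N → ℕ
outDeg A t a = countᵇ (λ b → R A t a b ∧ not ⌊ a ≟F b ⌋)

_⊨_ : ∀ {n m N} → Structure n m N → GP2 n m → Set
_⊨_ {n} {m} {N} A φ =
    (∀ (a : Fin N) → eval A (γ φ) (env1 a) ≡ true)
  × (∀ (i : Fin m) (a b : Fin N) → R A i a b ≡ true → a ≢ b →
       eval A (α φ i) (env2 a b) ≡ true)
  × (∀ (i : Fin n) (a : Fin N) → U A i a ≡ true →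
       holds (cmp φ i) (Σℤ (λ t → λc φ i t *ℤ + outDeg A t a)) (δ φ i))

FinSat : ∀ {n m} → GP2 n m → Set
FinSat {n} {m} φ = ∃[ N ] Σ (Structure n m (suc N)) (λ A → A ⊨ φ)

-- 1-types and 2-types.
-- A 1-type is determined by the truth values of U_i(x) (i < n) and R_i(x,x) (i < m).
-- A 2-type is determined by the truth values of R_i(x,y) and R_i(y,x) (i < m).

OneTp : ℕ → ℕ → Set
OneTp n m = Vec Bool n × Vec Bool m

TwoTp : ℕ → Set
TwoTp m = Vec Bool m × Vec Bool m   -- (R_i(x,y))_i , (R_i(y,x))_i

_≟1_ : ∀ {n m} → DecidableEquality (OneTp n m)
_≟1_ = PP.≡-dec (VP.≡-dec _≟B_) (VP.≡-dec _≟B_)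

_≟2_ : ∀ {m} → DecidableEquality (TwoTp m)
_≟2_ = PP.≡-dec (VP.≡-dec _≟B_) (VP.≡-dec _≟B_)

dual : ∀ {m} → TwoTp m → TwoTp m
dual = swap

silent : ∀ {m} → TwoTp m
silent = replicate _ false , replicate _ false

Audible : ∀ {m} → TwoTp m → Set
Audible η = η ≢ silent

inTwoTps : ∀ {m} → Fin m → TwoTp m → Bool
inTwoTps t η = lookup (proj₁ η) t

allBoolVecs : (k : ℕ) → List (Vec Bool k)
allBoolVecs zero = [] ∷ []
allBoolVecs (suc k) = concatMap (λ v → (true ∷ v) ∷ (false ∷ v) ∷ []) (allBoolVecs k)

allOneTps : ∀ n m → List (OneTp n m)
allOneTps n m = cartesianProduct (allBoolVecs n) (allBoolVecs m)

allTwoTps : ∀ m → List (TwoTp m)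
allTwoTps m = cartesianProduct (allBoolVecs m) (allBoolVecs m)

tp1 : ∀ {n m N} → Structure n m N → Fin N → OneTp n m
tp1 A a = tabulate (λ i → U A i a) , tabulate (λ i → R A i a a)

tp2 : ∀ {n m N} → Structure n m N → Fin N → Fin N → TwoTp m
tp2 A a b = tabulate (λ i → R A i a b) , tabulate (λ i → R A i b a)

-- Compatibility (entailment taken semantically over all finite structures).

OneCompat : ∀ {n m} → GP2 n m → OneTp n m → Set
OneCompat {n} {m} φ π =
  ∀ (N : ℕ) (A : Structure n m N) (a : Fin N) → tp1 A a ≡ π →
    eval A (γ φ) (env1 a) ≡ true

Entails2 : ∀ {n m} → GP2 n m → OneTp n m → TwoTp m → OneTp n m → Set
Entails2 {n} {m} φ π₁ η π₂ =
  ∀ (N : ℕ) (A : Structure n m N) (a b : Fin N) →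
    tp1 A a ≡ π₁ → tp2 A a b ≡ η → tp1 A b ≡ π₂ →
    ∀ (i : Fin m) → R A i a b ≡ true → a ≢ b →
      eval A (α φ i) (env2 a b) ≡ true

TripleCompat : ∀ {n m} → GP2 n m → OneTp n m → TwoTp m → OneTp n m → Set
TripleCompat φ π₁ η π₂ = Entails2 φ π₁ η π₂ × Entails2 φ π₂ (dual η) π₁

-- Characteristic system C^φ_π.  A vector f ∈ ℕ^(TwoTps⁺ × OneTps) is
-- represented as a function on TwoTps × OneTps whose entries at the silent
-- 2-type are ignored.

Vector : ℕ → ℕ → Set
Vector n m = TwoTp m → OneTp n m → ℕ

blockSum : ∀ {n m} → Vector n m → Fin m → ℕ
blockSum {n} {m} f t =
  sum (map (λ η → sum (map (λ π' → f η π') (allOneTps n m)))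
           (filterᵇ (inTwoTps t) (allTwoTps m)))

CharSol : ∀ {n m} → GP2 n m → OneTp n m → Vector n m → Set
CharSol {n} {m} φ π f =
    (∀ (η : TwoTp m) (π' : OneTp n m) → Audible η →
       (¬ OneCompat φ π' ⊎ ¬ TripleCompat φ π η π') → f η π' ≡ 0)
  × (∀ (i : Fin n) → lookup (proj₁ π) i ≡ true →
       holds (cmp φ i) (Σℤ (λ t → λc φ i t *ℤ + blockSum f t)) (δ φ i))

-- Colored graphs on vertex set Fin k.  twoTp is given on all ordered
-- pairs; only its values at distinct pairs are meaningful.

record ColoredGraph (n m k : ℕ) : Set where
  field
    oneTp   : Fin k → OneTp n m
    twoTp   : Fin k → Fin k → TwoTp m
    twoTp-dual : ∀ (v u : Fin k) → v ≢ u → twoTp u v ≡ dual (twoTp v u)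
open ColoredGraph public

bh : ∀ {n m k} → ColoredGraph n m k → Fin k → Vector n m
bh G v η π = countᵇ (λ u → not ⌊ v ≟F u ⌋ ∧ ⌊ twoTp G v u ≟2 η ⌋ ∧ ⌊ oneTp G u ≟1 π ⌋)

GoodGraph : ∀ {n m k} → GP2 n m → ColoredGraph n m k → Set
GoodGraph {n} {m} {k} φ G =
    (∀ (v : Fin k) → OneCompat φ (oneTp G v))
  × (∀ (v₁ v₂ : Fin k) → v₁ ≢ v₂ →
       TripleCompat φ (oneTp G v₁) (twoTp G v₁ v₂) (oneTp G v₂))
  × (∀ (v : Fin k) → CharSol φ (oneTp G v) (bh G v))

{-# OPTIONS --safe #-}

-- Quantifier-free formulas only see the 1-types of elements and the 2-types of
-- pairs, so a structure satisfies the γ- and α-conjuncts of φ exactly when all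
-- realized 1-types and triples are compatible with φ. The out-degree
-- #_y[R_t(v,y) ∧ v ≠ y] is the sum of bh(v) over the audible 2-types containing
-- R_t(x,y), so the counting conjuncts at v are exactly the characteristic
-- system of the 1-type of v. Hence a structure satisfies φ iff the colored graph
-- of its types is good, and every colored graph is the graph of types of the
-- structure that reads its relations off the colors.

module Submission where

open import Defs

open import Algebra.Properties.CommutativeSemigroup using (interchange)
open import Data.Bool using (Bool; true; false; _∧_; _∨_; not; if_then_else_; T; T?)
open import Data.Bool.Properties using (∧-zeroʳ; ∧-identityʳ; ∧-assoc; if-eta; if-∧)
open import Data.Empty using (⊥-elim)
open import Data.Fin using (Fin; zero; suc) renaming (_≟_ to _≟F_)
open import Data.Integer using () renaming (+_ to ℤ+_; _*_ to _*ℤ_)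
open import Data.List
  using (List; []; _∷_; _++_; map; length; filterᵇ; concatMap; cartesianProduct; allFin)
open import Data.List.Properties using (map-++; map-cong; map-∘; filter-all; filter-none)
import Data.List.Relation.Unary.All as All
open import Data.Nat using (ℕ; zero; suc; _+_)
open import Data.Nat.ListAction using (sum)
open import Data.Nat.ListAction.Properties using (sum-++)
open import Data.Nat.Properties using (+-identityʳ; +-commutativeSemigroup)
open import Data.Product using (Σ; ∃-syntax; _×_; _,_; proj₁; proj₂)
open import Data.Sum using (_⊎_; [_,_])
open import Data.Vec using (Vec; []; _∷_; tabulate; lookup)
open import Data.Vec.Properties
  using (lookup∘tabulate; tabulate∘lookup; tabulate-cong; ∷-injectiveʳ)
open import Function using (_∘_; const)
open import Function.Bundles using (_⇔_; mk⇔; Equivalence)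
open import Function.Definitions using (Injective)
open import Relation.Binary.Definitions using (DecidableEquality)
open import Relation.Binary.PropositionalEquality
  using (_≡_; _≢_; _≗_; refl; sym; trans; cong; cong₂; subst; subst₂; module ≡-Reasoning)
open import Relation.Nullary using (¬_; yes; no; does)
open import Relation.Nullary.Decidable using (⌊_⌋; isYes≗does; does-⇔)

open ≡-Reasoning

private
  variable
    A B : Set
    n m N M k : ℕ

-- Sums over lists

∑ : List A → (A → ℕ) → ℕ
∑ xs f = sum (map f xs)

∑-cong : ∀ (xs : List A) {f g : A → ℕ} → f ≗ g → ∑ xs f ≡ ∑ xs g
∑-cong xs f≗g = cong sum (map-cong f≗g xs)

∑-++ : ∀ (xs ys : List A) (f : A → ℕ) → ∑ (xs ++ ys) f ≡ ∑ xs f + ∑ ys f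
∑-++ xs ys f = trans (cong sum (map-++ f xs ys)) (sum-++ (map f xs) (map f ys))

∑-map : ∀ (g : A → B) (xs : List A) (f : B → ℕ) → ∑ (map g xs) f ≡ ∑ xs (f ∘ g)
∑-map g xs f = cong sum (sym (map-∘ xs))

∑-concatMap : ∀ (g : A → List B) (xs : List A) (f : B → ℕ) →
  ∑ (concatMap g xs) f ≡ ∑ xs (λ x → ∑ (g x) f)
∑-concatMap g [] f = refl
∑-concatMap g (x ∷ xs) f =
  trans (∑-++ (g x) (concatMap g xs) f) (cong (∑ (g x) f +_) (∑-concatMap g xs f))

∑-cartesianProduct : ∀ (xs : List A) (ys : List B) (f : A × B → ℕ) →
  ∑ (cartesianProduct xs ys) f ≡ ∑ xs (λ x → ∑ ys (λ y → f (x , y)))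
∑-cartesianProduct [] ys f = refl
∑-cartesianProduct (x ∷ xs) ys f =
  trans (∑-++ (map (x ,_) ys) (cartesianProduct xs ys) f)
        (cong₂ _+_ (∑-map (x ,_) ys f) (∑-cartesianProduct xs ys f))

∑-filterᵇ : ∀ (q : A → Bool) (xs : List A) (f : A → ℕ) →
  ∑ (filterᵇ q xs) f ≡ ∑ xs (λ x → if q x then f x else 0)
∑-filterᵇ q [] f = refl
∑-filterᵇ q (x ∷ xs) f with q x
... | true  = cong (f x +_) (∑-filterᵇ q xs f)
... | false = ∑-filterᵇ q xs f

∑-zero : ∀ (xs : List A) → ∑ xs (const 0) ≡ 0
∑-zero []       = refl
∑-zero (x ∷ xs) = ∑-zero xs

∑-+ : ∀ (xs : List A) (f g : A → ℕ) → ∑ xs (λ x → f x + g x) ≡ ∑ xs f + ∑ xs g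
∑-+ [] f g = refl
∑-+ (x ∷ xs) f g =
  trans (cong (f x + g x +_) (∑-+ xs f g))
        (interchange +-commutativeSemigroup (f x) (g x) (∑ xs f) (∑ xs g))

∑-comm : ∀ (xs : List A) (ys : List B) (f : A → B → ℕ) →
  ∑ xs (λ x → ∑ ys (f x)) ≡ ∑ ys (λ y → ∑ xs (λ x → f x y))
∑-comm [] ys f = sym (∑-zero ys)
∑-comm (x ∷ xs) ys f =
  trans (cong (∑ ys (f x) +_) (∑-comm xs ys f)) (sym (∑-+ ys (f x) (λ y → ∑ xs (λ x → f x y))))

indicator : Bool → ℕ
indicator b = if b then 1 else 0

length-filterᵇ : ∀ (p : A → Bool) (xs : List A) → length (filterᵇ p xs) ≡ ∑ xs (indicator ∘ p)
length-filterᵇ p [] = refl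
length-filterᵇ p (x ∷ xs) with p x
... | true  = cong suc (length-filterᵇ p xs)
... | false = length-filterᵇ p xs

countᵇ-∑ : ∀ (p : Fin N → Bool) → countᵇ p ≡ ∑ (allFin N) (indicator ∘ p)
countᵇ-∑ {N} p = length-filterᵇ p (allFin N)

countᵇ-cong : ∀ {p q : Fin N → Bool} → p ≗ q → countᵇ p ≡ countᵇ q
countᵇ-cong {N} {p} {q} p≗q =
  trans (countᵇ-∑ p) (trans (∑-cong (allFin N) (cong indicator ∘ p≗q)) (sym (countᵇ-∑ q)))

countᵇ-none : ∀ {p : Fin N → Bool} → (∀ u → ¬ T (p u)) → countᵇ p ≡ 0
countᵇ-none {N} {p} none = cong length (filter-none (T? ∘ p) (All.universal none (allFin N)))

-- Counting by fibres

-- Each element occurs exactly once in xs, stated without reference to a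
-- decision procedure for equality.
record Enumerates (xs : List A) : Set where
  constructor enumerates
  field
    ∑-supported-at : ∀ x (f : A → ℕ) → (∀ y → y ≢ x → f y ≡ 0) → ∑ xs f ≡ f x
open Enumerates

allBoolVecs-enumerates : ∀ k → Enumerates (allBoolVecs k)
allBoolVecs-enumerates zero    = enumerates λ { [] f _ → +-identityʳ (f []) }
allBoolVecs-enumerates (suc k) = enumerates λ { (b ∷ x) f f-off → cons b x f f-off }
  where
  cons : ∀ b x (f : Vec Bool (suc k) → ℕ) → (∀ y → y ≢ b ∷ x → f y ≡ 0) →
    ∑ (allBoolVecs (suc k)) f ≡ f (b ∷ x)
  cons b x f f-off = begin
    ∑ (allBoolVecs (suc k)) f
      ≡⟨ ∑-concatMap _ (allBoolVecs k) f ⟩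
    ∑ (allBoolVecs k) (λ v → f (true ∷ v) + (f (false ∷ v) + 0))
      ≡⟨ ∑-supported-at (allBoolVecs-enumerates k) x _ both-off ⟩
    f (true ∷ x) + (f (false ∷ x) + 0)
      ≡⟨ select b f-off ⟩
    f (b ∷ x) ∎
    where
    both-off : ∀ v → v ≢ x → f (true ∷ v) + (f (false ∷ v) + 0) ≡ 0
    both-off v v≢x =
      cong₂ _+_ (f-off _ (v≢x ∘ ∷-injectiveʳ)) (cong (_+ 0) (f-off _ (v≢x ∘ ∷-injectiveʳ)))
    select : ∀ b → (∀ y → y ≢ b ∷ x → f y ≡ 0) → f (true ∷ x) + (f (false ∷ x) + 0) ≡ f (b ∷ x)
    select true  off = trans (cong (λ z → f (true ∷ x) + (z + 0)) (off _ λ ())) (+-identityʳ _)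
    select false off = trans (cong (_+ (f (false ∷ x) + 0)) (off _ λ ())) (+-identityʳ _)

cartesianProduct-enumerates : ∀ {xs : List A} {ys : List B} →
  Enumerates xs → Enumerates ys → Enumerates (cartesianProduct xs ys)
cartesianProduct-enumerates {xs = xs} {ys} xs-enum ys-enum =
  enumerates λ { (x , y) f f-off → begin
    ∑ (cartesianProduct xs ys) f
      ≡⟨ ∑-cartesianProduct xs ys f ⟩
    ∑ xs (λ a → ∑ ys (λ b → f (a , b)))
      ≡⟨ ∑-cong xs (λ a → ∑-supported-at ys-enum y _ (λ b b≢y → f-off (a , b) (b≢y ∘ cong proj₂))) ⟩
    ∑ xs (λ a → f (a , y))
      ≡⟨ ∑-supported-at xs-enum x _ (λ a a≢x → f-off (a , y) (a≢x ∘ cong proj₁)) ⟩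
    f (x , y) ∎ }

allOneTps-enumerates : Enumerates (allOneTps n m)
allOneTps-enumerates {n} {m} =
  cartesianProduct-enumerates (allBoolVecs-enumerates n) (allBoolVecs-enumerates m)

allTwoTps-enumerates : Enumerates (allTwoTps m)
allTwoTps-enumerates {m} =
  cartesianProduct-enumerates (allBoolVecs-enumerates m) (allBoolVecs-enumerates m)

filterᵇ-true : ∀ (xs : List A) → filterᵇ (const true) xs ≡ xs
filterᵇ-true xs = filter-all (T? ∘ const true) (All.universal _ xs)

module _ {xs : List A} (xs-enum : Enumerates xs) (_≟_ : DecidableEquality A) where

  ∑-filterᵇ-fibre : ∀ (q : A → Bool) (c : Bool) (y : A) →
    ∑ (filterᵇ q xs) (λ a → indicator (c ∧ ⌊ y ≟ a ⌋)) ≡ indicator (q y ∧ c)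
  ∑-filterᵇ-fibre q c y = begin
    ∑ (filterᵇ q xs) (λ a → indicator (c ∧ ⌊ y ≟ a ⌋))
      ≡⟨ ∑-filterᵇ q xs _ ⟩
    ∑ xs (λ a → if q a then indicator (c ∧ ⌊ y ≟ a ⌋) else 0)
      ≡⟨ ∑-supported-at xs-enum y _ off-y ⟩
    (if q y then indicator (c ∧ ⌊ y ≟ y ⌋) else 0)
      ≡⟨ cong (λ b → if q y then indicator b else 0) at-y ⟩
    (if q y then indicator c else 0)
      ≡⟨ if-∧ (q y) ⟨
    indicator (q y ∧ c) ∎
    where
    off-y : ∀ a → a ≢ y → (if q a then indicator (c ∧ ⌊ y ≟ a ⌋) else 0) ≡ 0
    off-y a a≢y with y ≟ a
    ... | yes y≡a = ⊥-elim (a≢y (sym y≡a))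
    ... | no _    = trans (cong (λ b → if q a then indicator b else 0) (∧-zeroʳ c)) (if-eta (q a))
    at-y : c ∧ ⌊ y ≟ y ⌋ ≡ c
    at-y with y ≟ y
    ... | yes _   = ∧-identityʳ c
    ... | no y≢y  = ⊥-elim (y≢y refl)

  countᵇ-fibres : ∀ (q : A → Bool) (f : Fin N → A) (p : Fin N → Bool) →
    ∑ (filterᵇ q xs) (λ a → countᵇ (λ u → p u ∧ ⌊ f u ≟ a ⌋)) ≡ countᵇ (λ u → q (f u) ∧ p u)
  countᵇ-fibres {N} q f p = begin
    ∑ (filterᵇ q xs) (λ a → countᵇ (λ u → p u ∧ ⌊ f u ≟ a ⌋))
      ≡⟨ ∑-cong (filterᵇ q xs) (λ a → countᵇ-∑ (λ u → p u ∧ ⌊ f u ≟ a ⌋)) ⟩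
    ∑ (filterᵇ q xs) (λ a → ∑ (allFin N) (λ u → indicator (p u ∧ ⌊ f u ≟ a ⌋)))
      ≡⟨ ∑-comm (filterᵇ q xs) (allFin N) _ ⟩
    ∑ (allFin N) (λ u → ∑ (filterᵇ q xs) (λ a → indicator (p u ∧ ⌊ f u ≟ a ⌋)))
      ≡⟨ ∑-cong (allFin N) (λ u → ∑-filterᵇ-fibre q (p u) (f u)) ⟩
    ∑ (allFin N) (λ u → indicator (q (f u) ∧ p u))
      ≡⟨ countᵇ-∑ (λ u → q (f u) ∧ p u) ⟨
    countᵇ (λ u → q (f u) ∧ p u) ∎

  countᵇ-fibres-all : ∀ (f : Fin N → A) (p : Fin N → Bool) →
    ∑ xs (λ a → countᵇ (λ u → p u ∧ ⌊ f u ≟ a ⌋)) ≡ countᵇ p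
  countᵇ-fibres-all f p =
    trans (cong (λ ys → ∑ ys _) (sym (filterᵇ-true xs))) (countᵇ-fibres (const true) f p)

blockSum-bh : ∀ (G : ColoredGraph n m k) (v : Fin k) (t : Fin m) →
  blockSum (bh G v) t ≡ countᵇ (λ u → inTwoTps t (twoTp G v u) ∧ not ⌊ v ≟F u ⌋)
blockSum-bh {n} {m} {k} G v t = begin
  blockSum (bh G v) t
    ≡⟨ ∑-cong (filterᵇ (inTwoTps t) (allTwoTps m)) marginal ⟩
  ∑ (filterᵇ (inTwoTps t) (allTwoTps m)) (λ η → countᵇ (λ u → distinct u ∧ ⌊ twoTp G v u ≟2 η ⌋))
    ≡⟨ countᵇ-fibres allTwoTps-enumerates _≟2_ (inTwoTps t) (twoTp G v) distinct ⟩
  countᵇ (λ u → inTwoTps t (twoTp G v u) ∧ distinct u) ∎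
  where
  distinct : Fin k → Bool
  distinct u = not ⌊ v ≟F u ⌋
  marginal : ∀ η →
    ∑ (allOneTps n m) (bh G v η) ≡ countᵇ (λ u → distinct u ∧ ⌊ twoTp G v u ≟2 η ⌋)
  marginal η =
    trans (∑-cong (allOneTps n m) (λ π → countᵇ-cong (λ u → sym (∧-assoc (distinct u) _ _))))
          (countᵇ-fibres-all allOneTps-enumerates _≟1_ (oneTp G) _)

-- Quantifier-free formulas depend only on types

tabulate≡⇒≗lookup : ∀ {f : Fin n → A} {xs : Vec A n} → tabulate f ≡ xs → f ≗ lookup xs
tabulate≡⇒≗lookup {f = f} refl i = sym (lookup∘tabulate f i)

tabulate-injective : ∀ {f g : Fin n → A} → tabulate f ≡ tabulate g → f ≗ g
tabulate-injective {g = g} tf≡tg i = trans (tabulate≡⇒≗lookup tf≡tg i) (lookup∘tabulate g i)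

module _ {A : Structure n m N} {B : Structure n m M} {ρ : Fin k → Fin N} {σ : Fin k → Fin M}
         (ρ-injective : Injective _≡_ _≡_ ρ) (σ-injective : Injective _≡_ _≡_ σ)
         (tp1-agree : ∀ v → tp1 A (ρ v) ≡ tp1 B (σ v))
         (tp2-agree : ∀ v w → v ≢ w → tp2 A (ρ v) (ρ w) ≡ tp2 B (σ v) (σ w)) where

  eval-tp-invariant : ∀ (ψ : QF n m k) → eval A ψ ρ ≡ eval B ψ σ
  eval-tp-invariant ⊤′             = refl
  eval-tp-invariant (unary i v)    = tabulate-injective (cong proj₁ (tp1-agree v)) i
  eval-tp-invariant (binary i v w) with v ≟F w
  ... | yes refl = tabulate-injective (cong proj₂ (tp1-agree v)) i
  ... | no v≢w   = tabulate-injective (cong proj₁ (tp2-agree v w v≢w)) i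
  eval-tp-invariant (equal v w)    = begin
    ⌊ ρ v ≟F ρ w ⌋
      ≡⟨ isYes≗does (ρ v ≟F ρ w) ⟩
    does (ρ v ≟F ρ w)
      ≡⟨ does-⇔ (mk⇔ (cong σ ∘ ρ-injective) (cong ρ ∘ σ-injective)) (ρ v ≟F ρ w) (σ v ≟F σ w) ⟩
    does (σ v ≟F σ w)
      ≡⟨ isYes≗does (σ v ≟F σ w) ⟨
    ⌊ σ v ≟F σ w ⌋ ∎
  eval-tp-invariant (¬′ ψ)         = cong not (eval-tp-invariant ψ)
  eval-tp-invariant (ψ ∧′ χ)       = cong₂ _∧_ (eval-tp-invariant ψ) (eval-tp-invariant χ)
  eval-tp-invariant (ψ ∨′ χ)       = cong₂ _∨_ (eval-tp-invariant ψ) (eval-tp-invariant χ)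

env1-injective : ∀ {a : Fin N} → Injective _≡_ _≡_ (env1 a)
env1-injective {x = zero} {zero} _ = refl

env2-injective : ∀ {a b : Fin N} → a ≢ b → Injective _≡_ _≡_ (env2 a b)
env2-injective a≢b {zero}     {zero}     _   = refl
env2-injective a≢b {zero}     {suc zero} a≡b = ⊥-elim (a≢b a≡b)
env2-injective a≢b {suc zero} {zero}     b≡a = ⊥-elim (a≢b (sym b≡a))
env2-injective a≢b {suc zero} {suc zero} _   = refl

module _ {A : Structure n m N} {B : Structure n m M} where

  eval-env1 : ∀ {a b} → tp1 A a ≡ tp1 B b →
    ∀ (ψ : QF n m 1) → eval A ψ (env1 a) ≡ eval B ψ (env1 b)
  eval-env1 {a} {b} a≈b = eval-tp-invariant env1-injective env1-injective (const a≈b) tp2-agree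
    where
    tp2-agree : ∀ v w → v ≢ w → tp2 A (env1 a v) (env1 a w) ≡ tp2 B (env1 b v) (env1 b w)
    tp2-agree zero zero 0≢0 = ⊥-elim (0≢0 refl)

  eval-env2 : ∀ {a b a′ b′} → a ≢ b → a′ ≢ b′ →
    tp1 A a ≡ tp1 B a′ → tp2 A a b ≡ tp2 B a′ b′ → tp1 A b ≡ tp1 B b′ →
    ∀ (ψ : QF n m 2) → eval A ψ (env2 a b) ≡ eval B ψ (env2 a′ b′)
  eval-env2 {a} {b} {a′} {b′} a≢b a′≢b′ a≈a′ ab≈a′b′ b≈b′ =
    eval-tp-invariant (env2-injective a≢b) (env2-injective a′≢b′) tp1-agree tp2-agree
    where
    tp1-agree : ∀ v → tp1 A (env2 a b v) ≡ tp1 B (env2 a′ b′ v)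
    tp1-agree zero       = a≈a′
    tp1-agree (suc zero) = b≈b′
    tp2-agree : ∀ v w → v ≢ w →
      tp2 A (env2 a b v) (env2 a b w) ≡ tp2 B (env2 a′ b′ v) (env2 a′ b′ w)
    tp2-agree zero       zero       0≢0 = ⊥-elim (0≢0 refl)
    tp2-agree zero       (suc zero) _   = ab≈a′b′
    tp2-agree (suc zero) zero       _   = cong dual ab≈a′b′
    tp2-agree (suc zero) (suc zero) 1≢1 = ⊥-elim (1≢1 refl)

module _ (φ : GP2 n m) {A : Structure n m N} (A⊨φ : A ⊨ φ) where

  ⊨⇒OneCompat : ∀ {a π} → tp1 A a ≡ π → OneCompat φ π
  ⊨⇒OneCompat {a} a:π _ A′ a′ a′:π =
    trans (eval-env1 (trans a′:π (sym a:π)) (γ φ)) (proj₁ A⊨φ a)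

  ⊨⇒Entails2 : ∀ {a b π₁ η π₂} → a ≢ b →
    tp1 A a ≡ π₁ → tp2 A a b ≡ η → tp1 A b ≡ π₂ → Entails2 φ π₁ η π₂
  ⊨⇒Entails2 {a} {b} a≢b a:π₁ ab:η b:π₂ _ A′ a′ b′ a′:π₁ a′b′:η b′:π₂ i R-a′b′ a′≢b′ = begin
    eval A′ (α φ i) (env2 a′ b′)
      ≡⟨ eval-env2 a′≢b′ a≢b (trans a′:π₁ (sym a:π₁)) a′b′≈ab (trans b′:π₂ (sym b:π₂)) (α φ i) ⟩
    eval A (α φ i) (env2 a b)
      ≡⟨ proj₁ (proj₂ A⊨φ) i a b R-ab a≢b ⟩
    true ∎
    where
    a′b′≈ab : tp2 A′ a′ b′ ≡ tp2 A a b
    a′b′≈ab = trans a′b′:η (sym ab:η)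
    R-ab : R A i a b ≡ true
    R-ab = trans (sym (tabulate-injective (cong proj₁ a′b′≈ab) i)) R-a′b′

  ⊨⇒TripleCompat : ∀ {a b π₁ η π₂} → a ≢ b →
    tp1 A a ≡ π₁ → tp2 A a b ≡ η → tp1 A b ≡ π₂ → TripleCompat φ π₁ η π₂
  ⊨⇒TripleCompat a≢b a:π₁ ab:η b:π₂ =
    ⊨⇒Entails2 a≢b a:π₁ ab:η b:π₂ , ⊨⇒Entails2 (a≢b ∘ sym) b:π₂ (cong dual ab:η) a:π₁

bh-incompatible : ∀ (φ : GP2 n m) (G : ColoredGraph n m k) →
  (∀ v → OneCompat φ (oneTp G v)) →
  (∀ v₁ v₂ → v₁ ≢ v₂ → TripleCompat φ (oneTp G v₁) (twoTp G v₁ v₂) (oneTp G v₂)) →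
  ∀ v η π → ¬ OneCompat φ π ⊎ ¬ TripleCompat φ (oneTp G v) η π → bh G v η π ≡ 0
bh-incompatible φ G compat₁ compat₂ v η π incompatible = countᵇ-none uncounted
  where
  uncounted : ∀ u → ¬ T (not ⌊ v ≟F u ⌋ ∧ ⌊ twoTp G v u ≟2 η ⌋ ∧ ⌊ oneTp G u ≟1 π ⌋)
  uncounted u counted with v ≟F u | twoTp G v u ≟2 η | oneTp G u ≟1 π
  ... | yes _   | _        | _       = counted
  ... | no _    | no _     | _       = counted
  ... | no _    | yes _    | no _    = counted
  ... | no v≢u  | yes vu:η | yes u:π =
    [ (λ ¬compat₁ → ¬compat₁ (subst (OneCompat φ) u:π (compat₁ u)))
    , (λ ¬compat₂ → ¬compat₂ (subst₂ (TripleCompat φ (oneTp G v)) vu:η u:π (compat₂ v u v≢u)))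
    ] incompatible

-- Structures realizing a colored graph

record Realizes (A : Structure n m N) (G : ColoredGraph n m N) : Set where
  field
    oneTp-realized : ∀ a → tp1 A a ≡ oneTp G a
    twoTp-realized : ∀ a b → a ≢ b → tp2 A a b ≡ twoTp G a b

typeGraph : Structure n m N → ColoredGraph n m N
typeGraph A = record { oneTp = tp1 A ; twoTp = tp2 A ; twoTp-dual = λ _ _ _ → refl }

typeGraph-realized : ∀ (A : Structure n m N) → Realizes A (typeGraph A)
typeGraph-realized A = record { oneTp-realized = λ _ → refl ; twoTp-realized = λ _ _ _ → refl }

realization : ColoredGraph n m N → Structure n m N
realization G = record
  { U = λ i a → lookup (proj₁ (oneTp G a)) i
  ; R = λ i a b → if ⌊ a ≟F b ⌋ then lookup (proj₂ (oneTp G a)) i else inTwoTps i (twoTp G a b)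
  }

realization-realizes : ∀ (G : ColoredGraph n m N) → Realizes (realization G) G
realization-realizes G = record { oneTp-realized = one ; twoTp-realized = two }
  where
  loop : ∀ a i → R (realization G) i a a ≡ lookup (proj₂ (oneTp G a)) i
  loop a i with a ≟F a
  ... | yes _   = refl
  ... | no a≢a  = ⊥-elim (a≢a refl)
  edge : ∀ {a b} → a ≢ b → ∀ i → R (realization G) i a b ≡ inTwoTps i (twoTp G a b)
  edge {a} {b} a≢b i with a ≟F b
  ... | yes a≡b = ⊥-elim (a≢b a≡b)
  ... | no _    = refl
  one : ∀ a → tp1 (realization G) a ≡ oneTp G a
  one a = cong₂ _,_ (tabulate∘lookup _) (trans (tabulate-cong (loop a)) (tabulate∘lookup _))
  two : ∀ a b → a ≢ b → tp2 (realization G) a b ≡ twoTp G a b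
  two a b a≢b = cong₂ _,_
    (trans (tabulate-cong (edge a≢b)) (tabulate∘lookup _))
    (trans (tabulate-cong (edge (a≢b ∘ sym)))
           (trans (tabulate∘lookup _) (cong proj₁ (twoTp-dual G a b a≢b))))

module _ {A : Structure n m N} {G : ColoredGraph n m N} (A-realizes-G : Realizes A G) where
  open Realizes A-realizes-G

  U-realized : ∀ i a → U A i a ≡ lookup (proj₁ (oneTp G a)) i
  U-realized i a = tabulate≡⇒≗lookup (cong proj₁ (oneTp-realized a)) i

  R-realized : ∀ {a b} → a ≢ b → ∀ i → R A i a b ≡ inTwoTps i (twoTp G a b)
  R-realized {a} {b} a≢b i = tabulate≡⇒≗lookup (cong proj₁ (twoTp-realized a b a≢b)) i

  blockSum-realized : ∀ v t → blockSum (bh G v) t ≡ outDeg A t v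
  blockSum-realized v t = trans (blockSum-bh G v t) (countᵇ-cong edge)
    where
    edge : ∀ u → (inTwoTps t (twoTp G v u) ∧ not ⌊ v ≟F u ⌋) ≡ (R A t v u ∧ not ⌊ v ≟F u ⌋)
    edge u with v ≟F u
    ... | yes _  = trans (∧-zeroʳ _) (sym (∧-zeroʳ _))
    ... | no v≢u = cong (_∧ true) (sym (R-realized v≢u t))

  degree-realized : ∀ (φ : GP2 n m) i v →
    Σℤ (λ t → λc φ i t *ℤ ℤ+ outDeg A t v) ≡ Σℤ (λ t → λc φ i t *ℤ ℤ+ blockSum (bh G v) t)
  degree-realized φ i v =
    cong sumℤ (map-cong (λ t → cong (λ d → λc φ i t *ℤ ℤ+ d) (sym (blockSum-realized v t)))
                        (allFin m))

  ⊨⇒GoodGraph : ∀ (φ : GP2 n m) → A ⊨ φ → GoodGraph φ G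
  ⊨⇒GoodGraph φ A⊨φ =
    compat₁ , compat₂ , λ v → (λ η π _ → bh-incompatible φ G compat₁ compat₂ v η π) , counting v
    where
    compat₁ : ∀ v → OneCompat φ (oneTp G v)
    compat₁ v = ⊨⇒OneCompat φ A⊨φ (oneTp-realized v)
    compat₂ : ∀ v₁ v₂ → v₁ ≢ v₂ → TripleCompat φ (oneTp G v₁) (twoTp G v₁ v₂) (oneTp G v₂)
    compat₂ v₁ v₂ v₁≢v₂ = ⊨⇒TripleCompat φ A⊨φ v₁≢v₂
      (oneTp-realized v₁) (twoTp-realized v₁ v₂ v₁≢v₂) (oneTp-realized v₂)
    counting : ∀ v i → lookup (proj₁ (oneTp G v)) i ≡ true →
      holds (cmp φ i) (Σℤ (λ t → λc φ i t *ℤ ℤ+ blockSum (bh G v) t)) (δ φ i)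
    counting v i U-vi = subst (λ d → holds (cmp φ i) d (δ φ i)) (degree-realized φ i v)
      (proj₂ (proj₂ A⊨φ) i v (trans (U-realized i v) U-vi))

  GoodGraph⇒⊨ : ∀ (φ : GP2 n m) → GoodGraph φ G → A ⊨ φ
  GoodGraph⇒⊨ φ (compat₁ , compat₂ , solutions) = satisfies-γ , satisfies-α , satisfies-counting
    where
    satisfies-γ : ∀ a → eval A (γ φ) (env1 a) ≡ true
    satisfies-γ a = compat₁ a N A a (oneTp-realized a)
    satisfies-α : ∀ i a b → R A i a b ≡ true → a ≢ b → eval A (α φ i) (env2 a b) ≡ true
    satisfies-α i a b R-ab a≢b = proj₁ (compat₂ a b a≢b) N A a b
      (oneTp-realized a) (twoTp-realized a b a≢b) (oneTp-realized b) i R-ab a≢b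
    satisfies-counting : ∀ i a → U A i a ≡ true →
      holds (cmp φ i) (Σℤ (λ t → λc φ i t *ℤ ℤ+ outDeg A t a)) (δ φ i)
    satisfies-counting i a U-ia =
      subst (λ d → holds (cmp φ i) d (δ φ i)) (sym (degree-realized φ i a))
      (proj₂ (solutions a) i (trans (sym (U-realized i a)) U-ia))

  ⊨⇔GoodGraph : ∀ (φ : GP2 n m) → A ⊨ φ ⇔ GoodGraph φ G
  ⊨⇔GoodGraph φ = mk⇔ (⊨⇒GoodGraph φ) (GoodGraph⇒⊨ φ)

proposition14 : ∀ {n m : ℕ} (φ : GP2 n m) →
    FinSat φ ⇔ (∃[ k ] Σ (ColoredGraph n m (suc k)) (λ G → GoodGraph φ G))
proposition14 φ = mk⇔
  (λ (N , A , A⊨φ) → N , typeGraph A , to (⊨⇔GoodGraph (typeGraph-realized A) φ) A⊨φ)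
  (λ (k , G , good) → k , realization G , from (⊨⇔GoodGraph (realization-realizes G) φ) good)
  where open Equivalence
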